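{- Let $T$ be a decomposable tournament, $D$ a $\delta$-decomposition of $T$, and $M \in {\rm mc}(T)$. If $M \notin D$, then $o_T(M) \in \{1,2\}$ and $D \cap O_T(M) \neq \emptyset$.
   Context: A tournament $T$ is a finite vertex set $V(T)$ with an arc set $A(T)$ such that for all distinct $x,y$, exactly one of $(x,y),(y,x)$ lies in $A(T)$. A module of $T$ is a subset $M$ such that for all $x,y \in M$ and $v \notin M$, $(v,x)\in A(T)$ iff $(v,y)\in A(T)$; trivial modules are $\emptyset$, singletons and $V(T)$; $T$ is decomposable if it has a nontrivial module. With $\overline{X} = V(T)\setminus X$, a co-module is a set $M$ such that $M$ or $\overline{M}$ is a nontrivial module; a co-modular decomposition is a set of pairwise disjoint co-modules; $\Delta(T)$ is the largest size of a co-modular decomposition. A minimal co-module is one containing no other co-module; ${\rm mc}(T)$ is the set of these. A $\delta$-decomposition of $T$ is a co-modular decomposition $D$ with $|D|=\Delta(T)$ and $D\subseteq {\rm mc}(T)$. Two sets overlap if their intersection and both differences are nonempty. For $M \in {\rm mc}(T)$, $O_T(M)$ is the set of $N\in{\rm mc}(T)$ overlapping $M$, and $o_T(M)=|O_T(M)|$. -}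

module Defs where

open import Data.Nat using (ℕ; _≤_)
open import Data.Bool using (Bool; true; false; not)
open import Data.Fin using (Fin)
open import Data.Fin.Subset using (Subset; _∈_; _∉_; _⊆_; _∩_; ∁; ⊥; ⊤; ∣_∣; Nonempty)
open import Data.List using (List; length)
import Data.List.Membership.Propositional as LM
open import Data.List.Relation.Unary.All using (All)
open import Data.List.Relation.Unary.AllPairs using (AllPairs)
open import Data.List.Relation.Unary.Unique.Propositional using (Unique)
open import Data.Product using (Σ; ∃; _×_)
open import Data.Sum using (_⊎_)
open import Relation.Binary.PropositionalEquality using (_≡_; _≢_)
open import Relation.Nullary using (¬_)
open import Function.Bundles using (_⇔_)

-- A tournament on the vertex set Fin n: arc x y ≡ true iff (x,y) ∈ A(T).
record Tournament (n : ℕ) : Set where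
  field
    arc        : Fin n → Fin n → Bool
    irrefl     : ∀ x → arc x x ≡ false
    tournament : ∀ x y → x ≢ y → arc y x ≡ not (arc x y)
open Tournament public

module _ {n : ℕ} (T : Tournament n) where

  IsModule : Subset n → Set
  IsModule M = ∀ x y v → x ∈ M → y ∈ M → v ∉ M → arc T v x ≡ arc T v y

  Trivial : Subset n → Set
  Trivial M = (M ≡ ⊥) ⊎ (∣ M ∣ ≡ 1) ⊎ (M ≡ ⊤)

  NontrivialModule : Subset n → Set
  NontrivialModule M = IsModule M × ¬ Trivial M

  Decomposable : Set
  Decomposable = ∃ λ M → NontrivialModule M

  CoModule : Subset n → Set
  CoModule M = NontrivialModule M ⊎ NontrivialModule (∁ M)

  Disjoint : Subset n → Subset n → Set
  Disjoint A B = A ∩ B ≡ ⊥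

  -- a co-modular decomposition: a (duplicate-free) finite set of pairwise
  -- disjoint co-modules, represented as a list
  CoModularDecomposition : List (Subset n) → Set
  CoModularDecomposition D = Unique D × All CoModule D × AllPairs Disjoint D

  MinCoModule : Subset n → Set
  MinCoModule M = CoModule M × (∀ N → CoModule N → N ⊆ M → N ≡ M)

  DeltaDecomposition : List (Subset n) → Set
  DeltaDecomposition D =
    CoModularDecomposition D
    × (∀ D′ → CoModularDecomposition D′ → length D′ ≤ length D)
    × All MinCoModule D

  Overlap : Subset n → Subset n → Set
  Overlap A B = Nonempty (A ∩ B) × Nonempty (A ∩ ∁ B) × Nonempty (B ∩ ∁ A)

  InO : Subset n → Subset n → Set
  InO M N = MinCoModule N × Overlap M N

  HasSize : (Subset n → Set) → ℕ → Set
  HasSize P k = Σ (List (Subset n)) λ L → Unique L × (∀ N → (N LM.∈ L) ⇔ P N) × length L ≡ k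

  o≡ : Subset n → ℕ → Set
  o≡ M k = HasSize (InO M) k

module Submission where

-- Everything rests on the shape of two overlapping minimal co-modules M, N.
-- Minimality forbids a co-module strictly inside M; together with the closure
-- of modules under union, intersection and difference this shows that M and N
-- are nontrivial modules and that M ∩ N and M ∖ N are singletons, i.e.
-- M = {a , b} and N = {a , c}.  Two distinct minimal co-modules N₁ = {a , c}
-- and N₂ = {a , d} overlapping M = {a , b} in the same point a are impossible
-- (the "triangle" lemma forces an arc to equal its reverse), and since M has
-- only two points, no three distinct minimal co-modules overlap M.
-- Distinct minimal co-modules either overlap or are disjoint, so if no member
-- of D overlapped M, the list M ∷ D would be a larger co-modular decomposition.

open import Defs
open import Data.Nat using (ℕ; zero; suc; _≤_; s≤s) renaming (_≟_ to _≟ⁿ_)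
open import Data.Nat.Properties using (<-≤-trans; <-irrefl)
open import Data.Bool using (Bool; true; false; not)
open import Data.Bool.Properties using (not-¬; not-involutive)
import Data.Bool as Bool
open import Data.Fin using (Fin) renaming (_≟_ to _≟ᶠ_)
open import Data.Fin.Properties using (all?)
open import Data.Fin.Subset
  using (Subset; _⊆_; _∩_; _∪_; ∁; ⊤; ∣_∣; Empty; _-_)
  renaming (_∈_ to _∈ₛ_; _∉_ to _∉ₛ_; ⊥ to ∅)
open import Data.Fin.Subset.Properties
open import Data.Product using (∃; _×_; _,_; proj₁; proj₂)
open import Data.Sum using (_⊎_; inj₁; inj₂; [_,_])
open import Data.Empty using (⊥; ⊥-elim)
open import Function using (_∘_)
open import Function.Bundles using (_⇔_; mk⇔; Equivalence)
open import Relation.Binary.PropositionalEquality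
  using (_≡_; _≢_; refl; sym; cong; cong₂; subst; module ≡-Reasoning)
open import Relation.Nullary using (¬_; Dec; yes; no)
open import Relation.Nullary.Decidable using (_→-dec_; _×-dec_; _⊎-dec_; ¬?; map′)
open import Relation.Unary using (Decidable)
open import Data.Vec using ([]; _∷_)
open import Data.Vec.Properties using (≡-dec)
open import Data.List using (List; []; _∷_; map; _++_; length; filter)
open import Data.List.Membership.Propositional using (_∈_; _∉_; find; lose)
open import Data.List.Membership.Propositional.Properties
  using (∈-++⁺ˡ; ∈-++⁺ʳ; ∈-map⁺; ∈-map⁻; ∈-filter⁺; ∈-filter⁻)
open import Data.List.Relation.Unary.Any using (here; there; any?)
import Data.List.Relation.Unary.All as All
open import Data.List.Relation.Unary.All.Properties using (¬Any⇒All¬)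
open import Data.List.Relation.Unary.AllPairs using ([]; _∷_)
open import Data.List.Relation.Unary.Unique.Propositional using (Unique)
import Data.List.Relation.Unary.Unique.Propositional.Properties as Unique

allSubsets : (n : ℕ) → List (Subset n)
allSubsets zero    = [] ∷ []
allSubsets (suc n) = map (true ∷_) (allSubsets n) ++ map (false ∷_) (allSubsets n)

allSubsets-complete : ∀ {n} (p : Subset n) → p ∈ allSubsets n
allSubsets-complete []          = here refl
allSubsets-complete (true ∷ p)  = ∈-++⁺ˡ (∈-map⁺ (true ∷_) (allSubsets-complete p))
allSubsets-complete {suc n} (false ∷ p) =
  ∈-++⁺ʳ (map (true ∷_) (allSubsets n)) (∈-map⁺ (false ∷_) (allSubsets-complete p))

allSubsets-unique : ∀ n → Unique (allSubsets n)
allSubsets-unique zero    = All.[] ∷ []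
allSubsets-unique (suc n) =
  Unique.++⁺ (Unique.map⁺ ∷-injectiveʳ (allSubsets-unique n))
             (Unique.map⁺ ∷-injectiveʳ (allSubsets-unique n))
             different-heads
  where
    ∷-injectiveʳ : ∀ {b} {p q : Subset n} → b ∷ p ≡ b ∷ q → p ≡ q
    ∷-injectiveʳ refl = refl
    different-heads : ∀ {v} → ¬ (v ∈ map (true ∷_) (allSubsets n) × v ∈ map (false ∷_) (allSubsets n))
    different-heads (v∈₁ , v∈₂) with ∈-map⁻ (true ∷_) v∈₁ | ∈-map⁻ (false ∷_) v∈₂
    ... | _ , _ , refl | _ , _ , ()

∀-subsets? : ∀ {n} {P : Subset n → Set} → Decidable P → Dec (∀ p → P p)
∀-subsets? {n} P? =
  map′ (λ all p → All.lookup all (allSubsets-complete p)) (λ f → All.tabulate (λ {p} _ → f p))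
       (All.all? P? (allSubsets n))

∁-involutive : ∀ {n} (p : Subset n) → ∁ (∁ p) ≡ p
∁-involutive []      = refl
∁-involutive (b ∷ p) = cong₂ _∷_ (not-involutive b) (∁-involutive p)

two-points⇒2≤∣p∣ : ∀ {n} {p : Subset n} {x y} → x ∈ₛ p → y ∈ₛ p → x ≢ y → 2 ≤ ∣ p ∣
two-points⇒2≤∣p∣ {p = p} {x} {y} x∈p y∈p x≢y =
  <-≤-trans (s≤s 1≤∣p-x∣) (x∈p⇒∣p-x∣<∣p∣ x∈p)
  where
    y∈p-x : y ∈ₛ p - x
    y∈p-x = x∈p∧x≢y⇒x∈p-y y∈p (x≢y ∘ sym)
    1≤∣p-x∣ : 1 ≤ ∣ p - x ∣
    1≤∣p-x∣ = subst (_≤ ∣ p - x ∣) (∣⁅x⁆∣≡1 y)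
                (p⊆q⇒∣p∣≤∣q∣ (λ z∈⁅y⁆ → subst (_∈ₛ p - x) (sym (x∈⁅y⁆⇒x≡y y z∈⁅y⁆)) y∈p-x))

empty-difference⇒⊆ : ∀ {n} {A B : Subset n} → Empty (A ∩ ∁ B) → A ⊆ B
empty-difference⇒⊆ {B = B} empty {x} x∈A with x ∈? B
... | yes x∈B = x∈B
... | no  x∉B = ⊥-elim (empty (x , x∈p∩q⁺ (x∈A , x∉p⇒x∈∁p x∉B)))

distinct : ∀ {n} {A : Subset n} {x y} → x ∈ₛ A → y ∉ₛ A → x ≢ y
distinct x∈A y∉A refl = y∉A x∈A

module Theory {n : ℕ} (T : Tournament n) where

  union-module : ∀ {A B c} → IsModule T A → IsModule T B → c ∈ₛ A → c ∈ₛ B → IsModule T (A ∪ B)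
  union-module {A} {B} {c} modA modB c∈A c∈B x y v x∈A∪B y∈A∪B v∉A∪B =
    begin
      arc T v x ≡⟨ towards-c x x∈A∪B ⟩
      arc T v c ≡⟨ sym (towards-c y y∈A∪B) ⟩
      arc T v y ∎
    where
      open ≡-Reasoning
      towards-c : ∀ z → z ∈ₛ A ∪ B → arc T v z ≡ arc T v c
      towards-c z z∈A∪B with x∈p∪q⁻ A B z∈A∪B
      ... | inj₁ z∈A = modA z c v z∈A c∈A (v∉A∪B ∘ p⊆p∪q B)
      ... | inj₂ z∈B = modB z c v z∈B c∈B (v∉A∪B ∘ q⊆p∪q A B)

  intersection-module : ∀ {A B} → IsModule T A → IsModule T B → IsModule T (A ∩ B)
  intersection-module {A} {B} modA modB x y v x∈A∩B y∈A∩B v∉A∩B with v ∈? A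
  ... | yes v∈A = modB x y v (p∩q⊆q A B x∈A∩B) (p∩q⊆q A B y∈A∩B) (λ v∈B → v∉A∩B (x∈p∩q⁺ (v∈A , v∈B)))
  ... | no  v∉A = modA x y v (p∩q⊆p A B x∈A∩B) (p∩q⊆p A B y∈A∩B) v∉A

  -- For v ∈ A ∩ B the arcs between v and A ∖ B are those between w and A ∖ B
  -- reversed twice: once through B (a module containing v and w), once through A.
  difference-module : ∀ {A B w} → IsModule T A → IsModule T B → w ∈ₛ B → w ∉ₛ A
                    → IsModule T (A ∩ ∁ B)
  difference-module {A} {B} {w} modA modB w∈B w∉A x y v x∈A∖B y∈A∖B v∉A∖B with v ∈? A
  ... | no  v∉A = modA x y v (p∩q⊆p A (∁ B) x∈A∖B) (p∩q⊆p A (∁ B) y∈A∖B) v∉A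
  ... | yes v∈A =
    begin
      arc T v x       ≡⟨ tournament T x v (distinct v∈B x∉B ∘ sym) ⟩
      not (arc T x v) ≡⟨ cong not (modB v w x v∈B w∈B x∉B) ⟩
      not (arc T x w) ≡⟨ sym (tournament T x w (distinct x∈A w∉A)) ⟩
      arc T w x       ≡⟨ modA x y w x∈A y∈A w∉A ⟩
      arc T w y       ≡⟨ tournament T y w (distinct y∈A w∉A) ⟩
      not (arc T y w) ≡⟨ cong not (sym (modB v w y v∈B w∈B y∉B)) ⟩
      not (arc T y v) ≡⟨ sym (tournament T y v (distinct v∈B y∉B ∘ sym)) ⟩
      arc T v y       ∎
    where
      open ≡-Reasoning
      x∈A = p∩q⊆p A (∁ B) x∈A∖B
      y∈A = p∩q⊆p A (∁ B) y∈A∖B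
      x∉B = x∈∁p⇒x∉p (p∩q⊆q A (∁ B) x∈A∖B)
      y∉B = x∈∁p⇒x∉p (p∩q⊆q A (∁ B) y∈A∖B)
      v∈B : v ∈ₛ B
      v∈B with v ∈? B
      ... | yes v∈B = v∈B
      ... | no  v∉B = ⊥-elim (v∉A∖B (x∈p∩q⁺ (v∈A , x∉p⇒x∈∁p v∉B)))

  nontrivial-module : ∀ {K x y z} → IsModule T K → x ∈ₛ K → y ∈ₛ K → x ≢ y → z ∉ₛ K
                    → NontrivialModule T K
  nontrivial-module {K} {x} {y} {z} modK x∈K y∈K x≢y z∉K = modK , nontrivial
    where
      nontrivial : ¬ Trivial T K
      nontrivial (inj₁ K≡⊥)        = ∉⊥ (subst (x ∈ₛ_) K≡⊥ x∈K)
      nontrivial (inj₂ (inj₁ ∣K∣≡1)) with subst (2 ≤_) ∣K∣≡1 (two-points⇒2≤∣p∣ x∈K y∈K x≢y)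
      ... | s≤s ()
      nontrivial (inj₂ (inj₂ K≡⊤)) = z∉K (subst (z ∈ₛ_) (sym K≡⊤) ∈⊤)

  complement-coModule : ∀ {K} → NontrivialModule T K → CoModule T (∁ K)
  complement-coModule {K} ntK = inj₂ (subst (NontrivialModule T) (sym (∁-involutive K)) ntK)

  -- Three modules meeting in a point a cannot each own a private point
  -- (b ∈ A, c ∈ B₁, d ∈ B₂ outside the other two): following the arcs
  -- d → c → a → b → d through the modules reverses the arc between c and d.
  triangle : ∀ {A B₁ B₂ a b c d} → IsModule T A → IsModule T B₁ → IsModule T B₂
           → a ∈ₛ A → a ∈ₛ B₁ → a ∈ₛ B₂
           → b ∈ₛ A → b ∉ₛ B₁ → b ∉ₛ B₂
           → c ∈ₛ B₁ → c ∉ₛ A → c ∉ₛ B₂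
           → d ∈ₛ B₂ → d ∉ₛ A → d ∉ₛ B₁ → ⊥
  triangle {a = a} {b} {c} {d} modA mod₁ mod₂ a∈A a∈₁ a∈₂ b∈A b∉₁ b∉₂ c∈₁ c∉A c∉₂ d∈₂ d∉A d∉₁ =
    not-¬ refl arc-reversed
    where
      open ≡-Reasoning
      arc-reversed : arc T d c ≡ not (arc T d c)
      arc-reversed = begin
        arc T d c       ≡⟨ mod₁ c a d c∈₁ a∈₁ d∉₁ ⟩
        arc T d a       ≡⟨ modA a b d a∈A b∈A d∉A ⟩
        arc T d b       ≡⟨ tournament T b d (distinct b∈A d∉A) ⟩
        not (arc T b d) ≡⟨ cong not (sym (mod₂ a d b a∈₂ d∈₂ b∉₂)) ⟩
        not (arc T b a) ≡⟨ cong not (mod₁ a c b a∈₁ c∈₁ b∉₁) ⟩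
        not (arc T b c) ≡⟨ sym (tournament T b c (distinct b∈A c∉A)) ⟩
        arc T c b       ≡⟨ sym (modA a b c a∈A b∈A c∉A) ⟩
        arc T c a       ≡⟨ mod₂ a d c a∈₂ d∈₂ c∉₂ ⟩
        arc T c d       ≡⟨ tournament T d c (distinct d∈₂ c∉₂) ⟩
        not (arc T d c) ∎

  no-coModule-inside : ∀ {M K w} → MinCoModule T M → CoModule T K → K ⊆ M → w ∈ₛ M → w ∉ₛ K
                     → ⊥
  no-coModule-inside {w = w} (_ , minimal) coK K⊆M w∈M w∉K =
    w∉K (subst (w ∈ₛ_) (sym (minimal _ coK K⊆M)) w∈M)

  no-module-inside : ∀ {M K x y w} → MinCoModule T M → IsModule T K → K ⊆ M
                   → x ∈ₛ K → y ∈ₛ K → x ≢ y → w ∈ₛ M → w ∉ₛ K → ⊥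
  no-module-inside minM modK K⊆M x∈K y∈K x≢y w∈M w∉K =
    no-coModule-inside minM (inj₁ (nontrivial-module modK x∈K y∈K x≢y w∉K)) K⊆M w∈M w∉K

  -- A nontrivial module X containing ∁ M has its complement ∁ X inside M.
  no-module-covering-complement : ∀ {M X w} → MinCoModule T M → NontrivialModule T X → ∁ M ⊆ X
                                → w ∈ₛ M → w ∈ₛ X → ⊥
  no-module-covering-complement {M} {X} minM ntX ∁M⊆X w∈M w∈X =
    no-coModule-inside minM (complement-coModule ntX) ∁X⊆M w∈M (x∈p⇒x∉∁p w∈X)
    where
      ∁X⊆M : ∁ X ⊆ M
      ∁X⊆M x∈∁X = x∉∁p⇒x∈p (x∈∁p⇒x∉p x∈∁X ∘ ∁M⊆X)

  record OverlapPoints (M N : Subset n) : Set where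
    field
      a b c : Fin n
      a∈M : a ∈ₛ M
      a∈N : a ∈ₛ N
      b∈M : b ∈ₛ M
      b∉N : b ∉ₛ N
      c∈N : c ∈ₛ N
      c∉M : c ∉ₛ M

  overlap-points : ∀ {M N} → Overlap T M N → OverlapPoints M N
  overlap-points {M} {N} ((a , a∈M∩N) , (b , b∈M∖N) , (c , c∈N∖M)) = record
    { a = a ; b = b ; c = c
    ; a∈M = p∩q⊆p M N a∈M∩N ; a∈N = p∩q⊆q M N a∈M∩N
    ; b∈M = p∩q⊆p M (∁ N) b∈M∖N ; b∉N = x∈∁p⇒x∉p (p∩q⊆q M (∁ N) b∈M∖N)
    ; c∈N = p∩q⊆p N (∁ M) c∈N∖M ; c∉M = x∈∁p⇒x∉p (p∩q⊆q N (∁ M) c∈N∖M) }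

  swap : ∀ {M N} → OverlapPoints M N → OverlapPoints N M
  swap p = record
    { a = a ; b = c ; c = b ; a∈M = a∈N ; a∈N = a∈M ; b∈M = c∈N ; b∉N = c∉M ; c∈N = b∈M ; c∉M = b∉N }
    where open OverlapPoints p

  -- If N is a module, N ∪ ∁ M is one, and its
  -- complement M ∖ N is a co-module inside M missing a.  If ∁ N is a module
  -- meeting ∁ M, then ∁ M ∪ ∁ N is one, and its complement M ∩ N misses b.
  -- Otherwise ∁ M ⊆ N is a co-module inside N missing a.
  complement-not-module : ∀ {M N} → MinCoModule T M → MinCoModule T N → OverlapPoints M N
                        → ¬ NontrivialModule T (∁ M)
  complement-not-module {M} {N} minM minN p nt∁M@(mod∁M , _) with proj₁ minN
  ... | inj₁ (modN , _) =
        no-module-covering-complement minM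
          (nontrivial-module (union-module modN mod∁M c∈N (x∉p⇒x∈∁p c∉M))
             (p⊆p∪q (∁ M) a∈N) (p⊆p∪q (∁ M) c∈N) (distinct a∈M c∉M)
             (λ b∈N∪∁M → [ b∉N , x∈p⇒x∉∁p b∈M ] (x∈p∪q⁻ N (∁ M) b∈N∪∁M)))
          (q⊆p∪q N (∁ M)) a∈M (p⊆p∪q (∁ M) a∈N)
    where open OverlapPoints p
  ... | inj₂ (mod∁N , _) with nonempty? (∁ M ∩ ∁ N)
  ...   | yes (e , e∈∁M∩∁N) =
          no-module-covering-complement minM
            (nontrivial-module
               (union-module mod∁M mod∁N (p∩q⊆p (∁ M) (∁ N) e∈∁M∩∁N) (p∩q⊆q (∁ M) (∁ N) e∈∁M∩∁N))
               (p⊆p∪q (∁ N) (x∉p⇒x∈∁p c∉M)) (q⊆p∪q (∁ M) (∁ N) (x∉p⇒x∈∁p b∉N))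
               (distinct c∈N b∉N)
               (λ a∈∁M∪∁N → [ x∈p⇒x∉∁p a∈M , x∈p⇒x∉∁p a∈N ] (x∈p∪q⁻ (∁ M) (∁ N) a∈∁M∪∁N)))
            (p⊆p∪q (∁ N)) b∈M (q⊆p∪q (∁ M) (∁ N) (x∉p⇒x∈∁p b∉N))
    where open OverlapPoints p
  ...   | no  disjoint =
          no-coModule-inside minN (inj₁ nt∁M)
            (empty-difference⇒⊆ (λ { (x , x∈∁M∖N) →
               disjoint (x , x∈p∩q⁺ (p∩q⊆p (∁ M) (∁ N) x∈∁M∖N , p∩q⊆q (∁ M) (∁ N) x∈∁M∖N)) }))
            a∈N (x∈p⇒x∉∁p a∈M)
    where open OverlapPoints p

  overlapping-is-module : ∀ {M N} → MinCoModule T M → MinCoModule T N → OverlapPoints M N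
                        → NontrivialModule T M
  overlapping-is-module minM minN p with proj₁ minM
  ... | inj₁ ntM  = ntM
  ... | inj₂ nt∁M = ⊥-elim (complement-not-module minM minN p nt∁M)

  -- If minimal co-modules M and N overlap, then M ∩ N and M ∖ N are singletons:
  -- otherwise they would be nontrivial modules properly inside M.
  module Shape {M N} (minM : MinCoModule T M) (minN : MinCoModule T N) (p : OverlapPoints M N) where
    open OverlapPoints p

    modM : IsModule T M
    modM = proj₁ (overlapping-is-module minM minN p)

    modN : IsModule T N
    modN = proj₁ (overlapping-is-module minN minM (swap p))

    meet-unique : ∀ {x y} → x ∈ₛ M → x ∈ₛ N → y ∈ₛ M → y ∈ₛ N → x ≡ y
    meet-unique {x} {y} x∈M x∈N y∈M y∈N with x ≟ᶠ y
    ... | yes x≡y = x≡y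
    ... | no  x≢y = ⊥-elim
      (no-module-inside minM (intersection-module modM modN) (p∩q⊆p M N)
         (x∈p∩q⁺ (x∈M , x∈N)) (x∈p∩q⁺ (y∈M , y∈N)) x≢y b∈M (b∉N ∘ p∩q⊆q M N))

    difference-unique : ∀ {x y} → x ∈ₛ M → x ∉ₛ N → y ∈ₛ M → y ∉ₛ N → x ≡ y
    difference-unique {x} {y} x∈M x∉N y∈M y∉N with x ≟ᶠ y
    ... | yes x≡y = x≡y
    ... | no  x≢y = ⊥-elim
      (no-module-inside minM (difference-module modM modN c∈N c∉M) (p∩q⊆p M (∁ N))
         (x∈p∩q⁺ (x∈M , x∉p⇒x∈∁p x∉N)) (x∈p∩q⁺ (y∈M , x∉p⇒x∈∁p y∉N)) x≢y
         a∈M (λ a∈M∖N → x∈∁p⇒x∉p (p∩q⊆q M (∁ N) a∈M∖N) a∈N))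

  -- Two distinct minimal co-modules overlapping M cannot both contain the
  -- same point a of M: writing M = {a , b}, N₁ = {a , c}, N₂ = {a , d}
  -- contradicts the triangle lemma.
  no-shared-point : ∀ {M N₁ N₂ a} → MinCoModule T M → InO T M N₁ → InO T M N₂ → N₁ ≢ N₂
                  → a ∈ₛ M → a ∈ₛ N₁ → a ∈ₛ N₂ → ⊥
  no-shared-point {M} {N₁} {N₂} {a} minM (min₁ , o₁) (min₂ , o₂) N₁≢N₂ a∈M a∈₁ a∈₂ =
    triangle M₁.modM M₁.modN M₂.modN a∈M a∈₁ a∈₂ b∈M b∉₁ b∉₂ c∈₁ c∉M c∉₂ d∈₂ d∉M d∉₁
    where
      p₁ = overlap-points o₁
      p₂ = overlap-points o₂
      module M₁ = Shape minM min₁ p₁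
      module M₂ = Shape minM min₂ p₂
      module N₁ = Shape min₁ minM (swap p₁)
      module N₂ = Shape min₂ minM (swap p₂)
      open OverlapPoints p₁ using (b; b∈M; c; c∉M) renaming (b∉N to b∉₁; c∈N to c∈₁)
      open OverlapPoints p₂ using () renaming (c to d; c∈N to d∈₂; c∉M to d∉M)
      b∉₂ : b ∉ₛ N₂
      b∉₂ b∈₂ = b∉₁ (subst (_∈ₛ N₁) (M₂.meet-unique a∈M a∈₂ b∈M b∈₂) a∈₁)
      -- a minimal co-module P overlapping M is determined by its two points
      -- a ∈ M and e ∉ M
      ⊆-by-points : ∀ {P Q e} → (∀ {x y} → x ∈ₛ P → x ∈ₛ M → y ∈ₛ P → y ∈ₛ M → x ≡ y)
                  → (∀ {x y} → x ∈ₛ P → x ∉ₛ M → y ∈ₛ P → y ∉ₛ M → x ≡ y)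
                  → a ∈ₛ P → e ∈ₛ P → e ∉ₛ M → a ∈ₛ Q → e ∈ₛ Q → P ⊆ Q
      ⊆-by-points {Q = Q} meet diff a∈P e∈P e∉M a∈Q e∈Q {x} x∈P with x ∈? M
      ... | yes x∈M = subst (_∈ₛ Q) (meet a∈P a∈M x∈P x∈M) a∈Q
      ... | no  x∉M = subst (_∈ₛ Q) (diff e∈P e∉M x∈P x∉M) e∈Q
      c≢d : c ≢ d
      c≢d c≡d = N₁≢N₂ (⊆-antisym
        (⊆-by-points N₁.meet-unique N₁.difference-unique a∈₁ c∈₁ c∉M a∈₂ (subst (_∈ₛ N₂) (sym c≡d) d∈₂))
        (⊆-by-points N₂.meet-unique N₂.difference-unique a∈₂ d∈₂ d∉M a∈₁ (subst (_∈ₛ N₁) c≡d c∈₁)))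
      c∉₂ : c ∉ₛ N₂
      c∉₂ c∈₂ = c≢d (N₂.difference-unique c∈₂ c∉M d∈₂ d∉M)
      d∉₁ : d ∉ₛ N₁
      d∉₁ d∈₁ = c≢d (N₁.difference-unique c∈₁ c∉M d∈₁ d∉M)

  -- No three pairwise distinct minimal co-modules overlap M: each contains a
  -- point of M, two of these points coincide since M = {a₁ , b₁}, and that
  -- contradicts no-shared-point.
  at-most-two-overlapping : ∀ {M N₁ N₂ N₃} → MinCoModule T M → N₁ ≢ N₂ → N₁ ≢ N₃ → N₂ ≢ N₃
                          → InO T M N₁ → InO T M N₂ → InO T M N₃ → ⊥
  at-most-two-overlapping {M} {N₁} {N₂} {N₃} minM N₁≢N₂ N₁≢N₃ N₂≢N₃
                          in₁@(min₁ , o₁) in₂@(_ , o₂) in₃@(_ , o₃) =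
    pigeonhole (a₂ ∈? N₁) (a₃ ∈? N₁)
    where
      open OverlapPoints (overlap-points o₂) using () renaming (a to a₂; a∈M to a₂∈M; a∈N to a₂∈₂)
      open OverlapPoints (overlap-points o₃) using () renaming (a to a₃; a∈M to a₃∈M; a∈N to a₃∈₃)
      pigeonhole : Dec (a₂ ∈ₛ N₁) → Dec (a₃ ∈ₛ N₁) → ⊥
      pigeonhole (yes a₂∈₁) _          = no-shared-point minM in₁ in₂ N₁≢N₂ a₂∈M a₂∈₁ a₂∈₂
      pigeonhole (no  _)    (yes a₃∈₁) = no-shared-point minM in₁ in₃ N₁≢N₃ a₃∈M a₃∈₁ a₃∈₃
      pigeonhole (no  a₂∉₁) (no  a₃∉₁) = no-shared-point minM in₂ in₃ N₂≢N₃ a₃∈M a₃∈₂ a₃∈₃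
        where
          a₃∈₂ : a₃ ∈ₛ N₂
          a₃∈₂ = subst (_∈ₛ N₂)
                   (Shape.difference-unique minM min₁ (overlap-points o₁) a₂∈M a₂∉₁ a₃∈M a₃∉₁) a₂∈₂

  isModule? : Decidable (IsModule T)
  isModule? K = all? λ x → all? λ y → all? λ v →
    x ∈? K →-dec (y ∈? K →-dec (¬? (v ∈? K) →-dec (arc T v x Bool.≟ arc T v y)))

  trivial? : Decidable (Trivial T)
  trivial? K = ≡-dec Bool._≟_ K ∅ ⊎-dec (∣ K ∣ ≟ⁿ 1 ⊎-dec ≡-dec Bool._≟_ K ⊤)

  coModule? : Decidable (CoModule T)
  coModule? K = nontrivialModule? K ⊎-dec nontrivialModule? (∁ K)
    where
      nontrivialModule? : Decidable (NontrivialModule T)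
      nontrivialModule? K = isModule? K ×-dec ¬? (trivial? K)

  minCoModule? : Decidable (MinCoModule T)
  minCoModule? K = coModule? K ×-dec ∀-subsets? (λ N → coModule? N →-dec (N ⊆? K →-dec ≡-dec Bool._≟_ N K))

  InO? : ∀ M → Decidable (InO T M)
  InO? M N = minCoModule? N ×-dec (nonempty? (M ∩ N) ×-dec (nonempty? (M ∩ ∁ N) ×-dec nonempty? (N ∩ ∁ M)))

  -- Distinct minimal co-modules that do not overlap are disjoint: neither
  -- can contain the other, by minimality.
  disjoint-unless-overlapping : ∀ {M N} → MinCoModule T M → MinCoModule T N → M ≢ N
                              → ¬ Overlap T M N → Disjoint T M N
  disjoint-unless-overlapping {M} {N} minM minN M≢N ¬overlap
    with nonempty? (M ∩ N) | nonempty? (M ∩ ∁ N) | nonempty? (N ∩ ∁ M)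
  ... | no  M∩N-empty | _         | _ = Empty-unique M∩N-empty
  ... | yes _         | no  M∖N-empty | _ =
    ⊥-elim (M≢N (proj₂ minN M (proj₁ minM) (empty-difference⇒⊆ M∖N-empty)))
  ... | yes _         | yes _         | no N∖M-empty =
    ⊥-elim (M≢N (sym (proj₂ minM N (proj₁ minN) (empty-difference⇒⊆ N∖M-empty))))
  ... | yes meet      | yes M∖N       | yes N∖M = ⊥-elim (¬overlap (meet , M∖N , N∖M))

  -- A minimal co-module M outside a δ-decomposition D overlaps a member of D:
  -- otherwise M ∷ D would be a co-modular decomposition longer than D.
  overlaps-member : ∀ {D M} → DeltaDecomposition T D → MinCoModule T M → M ∉ D
                  → ∃ λ N → N ∈ D × InO T M N
  overlaps-member {D} {M} ((uniqueD , coModulesD , disjointD) , maximalD , minimalD) minM M∉D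
    with any? (InO? M) D
  ... | yes overlapping = find overlapping
  ... | no  none        = ⊥-elim (<-irrefl refl (maximalD (M ∷ D) extended))
    where
      disjoint-from-M : ∀ {N} → N ∈ D → Disjoint T M N
      disjoint-from-M N∈D = disjoint-unless-overlapping minM (All.lookup minimalD N∈D)
        (λ { refl → M∉D N∈D }) (λ o → none (lose N∈D (All.lookup minimalD N∈D , o)))
      extended : CoModularDecomposition T (M ∷ D)
      extended = ¬Any⇒All¬ D M∉D ∷ uniqueD , proj₁ minM All.∷ coModulesD
               , All.tabulate disjoint-from-M ∷ disjointD

  counted : ∀ {P} → Decidable P → ∃ (HasSize T P)
  counted {P} P? = length L , L , Unique.filter⁺ P? (allSubsets-unique n) , members , refl
    where
      L = filter P? (allSubsets n)
      members : ∀ N → (N ∈ L) ⇔ P N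
      members N = mk⇔ (proj₂ ∘ ∈-filter⁻ P? {xs = allSubsets n}) (∈-filter⁺ P? (allSubsets-complete N))

  one-or-two : ∀ {P} → ∃ (HasSize T P) → ∃ P
             → (∀ {N₁ N₂ N₃} → N₁ ≢ N₂ → N₁ ≢ N₃ → N₂ ≢ N₃ → P N₁ → P N₂ → P N₃ → ⊥)
             → HasSize T P 1 ⊎ HasSize T P 2
  one-or-two (_ , [] , _ , members , refl) (N , PN) _ with Equivalence.from (members N) PN
  ... | ()
  one-or-two (_ , L@(_ ∷ []) , unique , members , refl) _ _ = inj₁ (L , unique , members , refl)
  one-or-two (_ , L@(_ ∷ _ ∷ []) , unique , members , refl) _ _ = inj₂ (L , unique , members , refl)
  one-or-two {P} (_ , L@(_ ∷ _ ∷ _ ∷ _) , unique , members , _) _ no-three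
    with unique
  ... | (N₁≢N₂ All.∷ N₁≢N₃ All.∷ _) ∷ (N₂≢N₃ All.∷ _) ∷ _ =
    ⊥-elim (no-three N₁≢N₂ N₁≢N₃ N₂≢N₃
              (member (here refl)) (member (there (here refl))) (member (there (there (here refl)))))
    where
      member : ∀ {N} → N ∈ L → P N
      member {N} = Equivalence.to (members N)

corollary3 : ∀ {n : ℕ} (T : Tournament n) → Decomposable T
           → (D : List (Subset n)) → DeltaDecomposition T D
           → (M : Subset n) → MinCoModule T M → M ∉ D
           → (o≡ T M 1 ⊎ o≡ T M 2) × (∃ λ N → N ∈ D × InO T M N)
corollary3 T _ D δD M minM M∉D = size-of-O , overlapping
  where
    open Theory T
    overlapping : ∃ λ N → N ∈ D × InO T M N
    overlapping = overlaps-member δD minM M∉D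
    size-of-O : o≡ T M 1 ⊎ o≡ T M 2
    size-of-O = one-or-two (counted (InO? M)) (proj₁ overlapping , proj₂ (proj₂ overlapping))
                           (at-most-two-overlapping minM)
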